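{- Let $f_0(n)=\binom{2n-1}{n}$ for $n=1,2,\ldots$. Then for $1\le k\le n$, \[c_1(n,k)=\frac{2^{n-k}}{n!}\sum_{i=0}^k(-1)^{k-i}\binom{k}{i}\prod_{t=0}^{n-1}(i+2t).\]
   Context: $c_1(n,k)=\sum_{i_1+\cdots+i_k=n} f_{0}(i_1)\cdots f_{0}(i_k)$, the sum over all $k$-tuples of positive integers $(i_1,\ldots,i_k)$ with sum $n$. -}

module Defs where

open import Data.Nat using (ℕ; zero; suc; _+_; _*_; _∸_; _^_)
open import Data.Nat.Combinatorics using (_C_)
open import Data.List using (List; []; _∷_; map; concatMap; upTo)
open import Data.Nat.ListAction using (sum)
open import Data.Vec using (Vec; []; _∷_; foldr)
open import Data.Integer as ℤ using (ℤ)

f₀ : ℕ → ℕ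
f₀ n = (2 * n ∸ 1) C n

-- compositions n k : the list of all k-tuples (i₁,…,iₖ) of positive
-- integers with i₁ + ⋯ + iₖ = n (each exactly once).
compositions : ℕ → (k : ℕ) → List (Vec ℕ k)
compositions zero    zero    = [] ∷ []
compositions (suc n) zero    = []
compositions n       (suc k) =
  concatMap (λ j → map (λ v → suc j ∷ v) (compositions (n ∸ suc j) k))
            (upTo n)

prodF₀ : {k : ℕ} → Vec ℕ k → ℕ
prodF₀ = foldr _ (λ i acc → f₀ i * acc) 1

c₁ : ℕ → ℕ → ℕ
c₁ n k = sum (map prodF₀ (compositions n k))

sumℤ : ℕ → (ℕ → ℤ) → ℤ
sumℤ zero    g = g 0
sumℤ (suc m) g = sumℤ m g ℤ.+ g (suc m)

prodℕ : ℕ → (ℕ → ℕ) → ℕ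
prodℕ zero    g = 1
prodℕ (suc m) g = prodℕ m g * g m

sign : ℕ → ℤ
sign zero = ℤ.+ 1
sign (suc m) = ℤ.- sign m

-- Put E_k(n) = 2^k n! c₁(n,k) and let ⋆ be binomial convolution, the product of exponential
-- generating functions. Splitting off the first part of a composition gives E_{k+1} = g ⋆ E_k,
-- where g(0) = 0 and g(j) = 2 j! f₀(j) = (2j)!/j! = ∏_{t<j} (2 + 4t) for j ≥ 1; that is,
-- g = R₁ − δ with R_i(n) = ∏_{t<n} (2i + 4t). Like all rising factorials of fixed step, these
-- satisfy the binomial theorem R_{i+1} = R₁ ⋆ R_i, so E_k = (R₁ − δ)^{⋆k} expands to
-- E_k(n) = Σ_i (−1)^{k−i} C(k,i) R_i(n), and finally R_i(n) = 2^n ∏_{t<n} (i + 2t).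

module Submission where

open import Defs
open import Data.Nat as ℕ using (ℕ; zero; suc; _≤_; _∸_; _^_; _!; z≤n)
import Data.Nat.Properties as ℕ
open import Data.Nat.Combinatorics
  using (_C_; nCk+nC[k+1]≡[n+1]C[k+1]; k>n⇒nCk≡0; nCk≡n!/k![n-k]!; k![n∸k]!∣n!)
open import Data.Nat.DivMod using (m/n*n≡m)
import Data.Nat.Tactic.RingSolver as ℕ-Ring
open import Data.Nat.ListAction using (sum)
open import Data.Nat.ListAction.Properties using (sum-++)
open import Data.List using (List; []; _∷_; map; concatMap; upTo; _++_; _∷ʳ_)
open import Data.List.Properties using (map-++; map-cong; upTo-∷ʳ)
open import Data.Vec using (Vec; _∷_)
open import Data.Integer using (ℤ; +_; _+_; _*_; -_; _-_)
import Data.Integer.Properties as ℤ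
open import Data.Integer.Tactic.RingSolver using (solve-∀)
open import Function using (_∘_)
open import Relation.Binary.PropositionalEquality
open ≡-Reasoning

sumℤ-cong : ∀ n {f g : ℕ → ℤ} → (∀ j → j ≤ n → f j ≡ g j) → sumℤ n f ≡ sumℤ n g
sumℤ-cong zero    f≡g = f≡g 0 z≤n
sumℤ-cong (suc n) f≡g =
  cong₂ _+_ (sumℤ-cong n (λ j j≤n → f≡g j (ℕ.m≤n⇒m≤1+n j≤n))) (f≡g (suc n) ℕ.≤-refl)

sumℤ-+ : ∀ n (f g : ℕ → ℤ) → sumℤ n (λ j → f j + g j) ≡ sumℤ n f + sumℤ n g
sumℤ-+ zero    f g = refl
sumℤ-+ (suc n) f g = begin
  sumℤ n (λ j → f j + g j) + (f (suc n) + g (suc n))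
    ≡⟨ cong (_+ (f (suc n) + g (suc n))) (sumℤ-+ n f g) ⟩
  sumℤ n f + sumℤ n g + (f (suc n) + g (suc n))
    ≡⟨ interchange (sumℤ n f) (sumℤ n g) (f (suc n)) (g (suc n)) ⟩
  sumℤ (suc n) f + sumℤ (suc n) g ∎
  where
  interchange : ∀ a b c d → a + b + (c + d) ≡ a + c + (b + d)
  interchange = solve-∀

*-sumℤ : ∀ n c (f : ℕ → ℤ) → c * sumℤ n f ≡ sumℤ n (λ j → c * f j)
*-sumℤ zero    c f = refl
*-sumℤ (suc n) c f =
  trans (ℤ.*-distribˡ-+ c (sumℤ n f) (f (suc n))) (cong (_+ c * f (suc n)) (*-sumℤ n c f))

neg-sumℤ : ∀ n (f : ℕ → ℤ) → - sumℤ n f ≡ sumℤ n (λ j → - f j)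
neg-sumℤ zero    f = refl
neg-sumℤ (suc n) f =
  trans (ℤ.neg-distrib-+ (sumℤ n f) (f (suc n))) (cong (_+ - f (suc n)) (neg-sumℤ n f))

sumℤ-zero : ∀ n → sumℤ n (λ _ → + 0) ≡ + 0
sumℤ-zero zero    = refl
sumℤ-zero (suc n) = cong (_+ + 0) (sumℤ-zero n)

sumℤ-suc : ∀ n (f : ℕ → ℤ) → sumℤ (suc n) f ≡ f 0 + sumℤ n (λ j → f (suc j))
sumℤ-suc zero    f = refl
sumℤ-suc (suc n) f = trans (cong (_+ f (suc (suc n))) (sumℤ-suc n f)) (ℤ.+-assoc (f 0) _ _)

sumℤ-comm : ∀ m n (h : ℕ → ℕ → ℤ) →
  sumℤ m (λ i → sumℤ n (λ j → h i j)) ≡ sumℤ n (λ j → sumℤ m (λ i → h i j))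
sumℤ-comm zero    n h = refl
sumℤ-comm (suc m) n h =
  trans (cong (_+ sumℤ n (h (suc m))) (sumℤ-comm m n h))
        (sym (sumℤ-+ n (λ j → sumℤ m (λ i → h i j)) (h (suc m))))

infixl 7 _⋆_

_⋆_ : (ℕ → ℤ) → (ℕ → ℤ) → ℕ → ℤ
(A ⋆ B) n = sumℤ n (λ j → + (n C j) * A j * B (n ∸ j))

⋆-cong : ∀ {A A′ B B′} → A ≗ A′ → B ≗ B′ → A ⋆ B ≗ A′ ⋆ B′
⋆-cong A≗A′ B≗B′ n = sumℤ-cong n (λ j _ → cong₂ (λ a b → + (n C j) * a * b) (A≗A′ j) (B≗B′ (n ∸ j)))

⋆-suc : ∀ A B n → (A ⋆ B) (suc n) ≡ (A ∘ suc ⋆ B) n + (A ⋆ B ∘ suc) n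
⋆-suc A B n = begin
  (A ⋆ B) (suc n)
    ≡⟨ sumℤ-suc n _ ⟩
  X + sumℤ n (λ j → + (suc n C suc j) * A (suc j) * B (n ∸ j))
    ≡⟨ cong (λ z → X + z) (trans (sumℤ-cong n pascal) (sumℤ-+ n _ _)) ⟩
  X + ((A ∘ suc ⋆ B) n + Y)
    ≡⟨ x+[y+z]≡y+[x+z] X ((A ∘ suc ⋆ B) n) Y ⟩
  (A ∘ suc ⋆ B) n + (X + Y)
    ≡⟨ cong (λ z → (A ∘ suc ⋆ B) n + z) X+Y≡A⋆B∘suc ⟩
  (A ∘ suc ⋆ B) n + (A ⋆ B ∘ suc) n ∎
  where
  R : ℕ → ℤ
  R j = + (n C j) * A j * B (suc n ∸ j)
  X = R 0
  Y = sumℤ n (λ j → R (suc j))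

  x+[y+z]≡y+[x+z] : ∀ x y z → x + (y + z) ≡ y + (x + z)
  x+[y+z]≡y+[x+z] = solve-∀

  pascal : ∀ j → j ≤ n → + (suc n C suc j) * A (suc j) * B (n ∸ j)
                         ≡ + (n C j) * A (suc j) * B (n ∸ j) + R (suc j)
  pascal j _ = begin
    + (suc n C suc j) * a * b
      ≡⟨ cong (λ c → + c * a * b) (sym (nCk+nC[k+1]≡[n+1]C[k+1] n j)) ⟩
    + (n C j ℕ.+ n C suc j) * a * b
      ≡⟨ cong (λ c → c * a * b) (ℤ.pos-+ (n C j) (n C suc j)) ⟩
    (+ (n C j) + + (n C suc j)) * a * b
      ≡⟨ distrib (+ (n C j)) (+ (n C suc j)) a b ⟩
    + (n C j) * a * b + + (n C suc j) * a * b ∎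
    where
    a = A (suc j)
    b = B (n ∸ j)
    distrib : ∀ c d a b → (c + d) * a * b ≡ c * a * b + d * a * b
    distrib = solve-∀

  R-top : R (suc n) ≡ + 0
  R-top = begin
    + (n C suc n) * A (suc n) * B (n ∸ n)
      ≡⟨ cong (λ c → + c * A (suc n) * B (n ∸ n)) (k>n⇒nCk≡0 (ℕ.n<1+n n)) ⟩
    + 0 * A (suc n) * B (n ∸ n)
      ≡⟨ cong (_* B (n ∸ n)) (ℤ.*-zeroˡ (A (suc n))) ⟩
    + 0 * B (n ∸ n)
      ≡⟨ ℤ.*-zeroˡ (B (n ∸ n)) ⟩
    + 0 ∎

  X+Y≡A⋆B∘suc : X + Y ≡ (A ⋆ B ∘ suc) n
  X+Y≡A⋆B∘suc = begin
    X + Y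
      ≡⟨ sym (sumℤ-suc n R) ⟩
    sumℤ n R + R (suc n)
      ≡⟨ cong (λ z → sumℤ n R + z) R-top ⟩
    sumℤ n R + + 0
      ≡⟨ ℤ.+-identityʳ (sumℤ n R) ⟩
    sumℤ n R
      ≡⟨ sumℤ-cong n (λ j j≤n → cong (λ m → + (n C j) * A j * B m) (ℕ.+-∸-assoc 1 j≤n)) ⟩
    (A ⋆ B ∘ suc) n ∎

δ : ℕ → ℤ
δ zero    = + 1
δ (suc _) = + 0

δ-⋆ : ∀ B → δ ⋆ B ≗ B
δ-⋆ B zero    = ℤ.*-identityˡ (B 0)
δ-⋆ B (suc n) = begin
  (δ ⋆ B) (suc n)
    ≡⟨ sumℤ-suc n _ ⟩
  + 1 * + 1 * B (suc n) + sumℤ n (λ j → + (suc n C suc j) * + 0 * B (n ∸ j))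
    ≡⟨ cong₂ _+_ (ℤ.*-identityˡ (B (suc n)))
                 (sumℤ-cong n (λ j _ → c*0*b≡0 (+ (suc n C suc j)) (B (n ∸ j)))) ⟩
  B (suc n) + sumℤ n (λ _ → + 0)
    ≡⟨ cong (λ z → B (suc n) + z) (sumℤ-zero n) ⟩
  B (suc n) + + 0
    ≡⟨ ℤ.+-identityʳ (B (suc n)) ⟩
  B (suc n) ∎
  where
  c*0*b≡0 : ∀ c b → c * + 0 * b ≡ + 0
  c*0*b≡0 = solve-∀

⋆-negʳ : ∀ A B n → (A ⋆ -_ ∘ B) n ≡ - (A ⋆ B) n
⋆-negʳ A B n =
  trans (sumℤ-cong n (λ j _ → c*a*[-b]≡-[c*a*b] (+ (n C j)) (A j) (B (n ∸ j)))) (sym (neg-sumℤ n _))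
  where
  c*a*[-b]≡-[c*a*b] : ∀ c a b → c * a * (- b) ≡ - (c * a * b)
  c*a*[-b]≡-[c*a*b] = solve-∀

⋆-subˡ : ∀ A A′ B n → ((λ j → A j - A′ j) ⋆ B) n ≡ (A ⋆ B) n - (A′ ⋆ B) n
⋆-subˡ A A′ B n = begin
  ((λ j → A j - A′ j) ⋆ B) n
    ≡⟨ sumℤ-cong n (λ j _ → distrib (+ (n C j)) (A j) (A′ j) (B (n ∸ j))) ⟩
  sumℤ n (λ j → + (n C j) * A j * B (n ∸ j) + - (+ (n C j) * A′ j * B (n ∸ j)))
    ≡⟨ sumℤ-+ n _ _ ⟩
  (A ⋆ B) n + sumℤ n (λ j → - (+ (n C j) * A′ j * B (n ∸ j)))
    ≡⟨ cong (λ z → (A ⋆ B) n + z) (sym (neg-sumℤ n _)) ⟩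
  (A ⋆ B) n - (A′ ⋆ B) n ∎
  where
  distrib : ∀ c a a′ b → c * (a - a′) * b ≡ c * a * b + - (c * a′ * b)
  distrib = solve-∀

⋆-linearʳ : ∀ A (c : ℕ → ℤ) (F : ℕ → ℕ → ℤ) k n →
  (A ⋆ (λ m → sumℤ k (λ i → c i * F i m))) n ≡ sumℤ k (λ i → c i * (A ⋆ F i) n)
⋆-linearʳ A c F k n = begin
  (A ⋆ (λ m → sumℤ k (λ i → c i * F i m))) n
    ≡⟨ sumℤ-cong n (λ j _ → *-sumℤ k (+ (n C j) * A j) (λ i → c i * F i (n ∸ j))) ⟩
  sumℤ n (λ j → sumℤ k (λ i → + (n C j) * A j * (c i * F i (n ∸ j))))
    ≡⟨ sumℤ-comm n k _ ⟩
  sumℤ k (λ i → sumℤ n (λ j → + (n C j) * A j * (c i * F i (n ∸ j))))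
    ≡⟨ sumℤ-cong k (λ i _ → sumℤ-cong n (λ j _ →
         x*[y*z]≡y*[x*z] (+ (n C j) * A j) (c i) (F i (n ∸ j)))) ⟩
  sumℤ k (λ i → sumℤ n (λ j → c i * (+ (n C j) * A j * F i (n ∸ j))))
    ≡⟨ sumℤ-cong k (λ i _ → sym (*-sumℤ n (c i) _)) ⟩
  sumℤ k (λ i → c i * (A ⋆ F i) n) ∎
  where
  x*[y*z]≡y*[x*z] : ∀ x y z → x * (y * z) ≡ y * (x * z)
  x*[y*z]≡y*[x*z] = solve-∀

Δ : ℕ → (ℕ → ℤ) → ℤ
Δ k W = sumℤ k (λ i → sign (k ∸ i) * + (k C i) * W i)

Δ≡⋆sign : ∀ k W → Δ k W ≡ (W ⋆ sign) k
Δ≡⋆sign k W = sumℤ-cong k (λ i _ → x*y*z≡y*z*x (sign (k ∸ i)) (+ (k C i)) (W i))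
  where
  x*y*z≡y*z*x : ∀ x y z → x * y * z ≡ y * z * x
  x*y*z≡y*z*x = solve-∀

Δ-suc : ∀ k W → Δ (suc k) W ≡ Δ k (W ∘ suc) - Δ k W
Δ-suc k W = begin
  Δ (suc k) W
    ≡⟨ Δ≡⋆sign (suc k) W ⟩
  (W ⋆ sign) (suc k)
    ≡⟨ ⋆-suc W sign k ⟩
  (W ∘ suc ⋆ sign) k + (W ⋆ -_ ∘ sign) k
    ≡⟨ cong₂ _+_ (sym (Δ≡⋆sign k (W ∘ suc))) (⋆-negʳ W sign k) ⟩
  Δ k (W ∘ suc) - (W ⋆ sign) k
    ≡⟨ cong (λ z → Δ k (W ∘ suc) - z) (sym (Δ≡⋆sign k W)) ⟩
  Δ k (W ∘ suc) - Δ k W ∎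

Δ-cong : ∀ k {W W′} → W ≗ W′ → Δ k W ≡ Δ k W′
Δ-cong k W≗W′ = sumℤ-cong k (λ i _ → cong (sign (k ∸ i) * + (k C i) *_) (W≗W′ i))

Δ-* : ∀ k c W → Δ k (λ i → c * W i) ≡ c * Δ k W
Δ-* k c W =
  trans (sumℤ-cong k (λ i _ → x*[y*z]≡y*[x*z] (sign (k ∸ i) * + (k C i)) c (W i))) (sym (*-sumℤ k c _))
  where
  x*[y*z]≡y*[x*z] : ∀ x y z → x * (y * z) ≡ y * (x * z)
  x*[y*z]≡y*[x*z] = solve-∀

rising : ℤ → ℤ → ℕ → ℤ
rising h x zero    = + 1
rising h x (suc n) = rising h x n * (x + h * + n)

rising-zero : ∀ h → rising h (+ 0) ≗ δ
rising-zero h zero          = refl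
rising-zero h (suc zero)    = trans (ℤ.*-identityˡ _) (trans (ℤ.+-identityˡ (h * + 0)) (ℤ.*-zeroʳ h))
rising-zero h (suc (suc n)) =
  trans (cong (_* (+ 0 + h * + suc n)) (rising-zero h (suc n))) (ℤ.*-zeroˡ (+ 0 + h * + suc n))

rising-+ : ∀ h x y → rising h (x + y) ≗ rising h x ⋆ rising h y
rising-+ h x y zero    = refl
rising-+ h x y (suc n) = begin
  rising h (x + y) n * s
    ≡⟨ cong (_* s) (rising-+ h x y n) ⟩
  (a ⋆ b) n * s
    ≡⟨ ℤ.*-comm ((a ⋆ b) n) s ⟩
  s * (a ⋆ b) n
    ≡⟨ *-sumℤ n s _ ⟩
  sumℤ n (λ j → s * (+ (n C j) * a j * b (n ∸ j)))
    ≡⟨ sumℤ-cong n split ⟩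
  sumℤ n (λ j → + (n C j) * a (suc j) * b (n ∸ j) + + (n C j) * a j * b (suc (n ∸ j)))
    ≡⟨ sumℤ-+ n _ _ ⟩
  (a ∘ suc ⋆ b) n + (a ⋆ b ∘ suc) n
    ≡⟨ sym (⋆-suc a b n) ⟩
  (a ⋆ b) (suc n) ∎
  where
  a = rising h x
  b = rising h y
  s = x + y + h * + n

  distrib : ∀ x y h j d c a b → (x + y + h * (j + d)) * (c * a * b)
                                ≡ c * (a * (x + h * j)) * b + c * a * (b * (y + h * d))
  distrib = solve-∀

  split : ∀ j → j ≤ n → s * (+ (n C j) * a j * b (n ∸ j))
                        ≡ + (n C j) * a (suc j) * b (n ∸ j) + + (n C j) * a j * b (suc (n ∸ j))
  split j j≤n = begin
    s * (+ (n C j) * a j * b (n ∸ j))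
      ≡⟨ cong (λ m → (x + y + h * m) * (+ (n C j) * a j * b (n ∸ j))) n≡j+[n∸j] ⟩
    (x + y + h * (+ j + + (n ∸ j))) * (+ (n C j) * a j * b (n ∸ j))
      ≡⟨ distrib x y h (+ j) (+ (n ∸ j)) (+ (n C j)) (a j) (b (n ∸ j)) ⟩
    + (n C j) * a (suc j) * b (n ∸ j) + + (n C j) * a j * b (suc (n ∸ j)) ∎
    where
    n≡j+[n∸j] : + n ≡ + j + + (n ∸ j)
    n≡j+[n∸j] = trans (cong +_ (sym (ℕ.m+[n∸m]≡n j≤n))) (ℤ.pos-+ j (n ∸ j))

sum-map-concatMap : ∀ {A B : Set} (h : A → ℕ) (G : B → List A) (bs : List B) →
  sum (map h (concatMap G bs)) ≡ sum (map (λ b → sum (map h (G b))) bs)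
sum-map-concatMap h G []       = refl
sum-map-concatMap h G (b ∷ bs) = begin
  sum (map h (G b ++ concatMap G bs))
    ≡⟨ cong sum (map-++ h (G b) (concatMap G bs)) ⟩
  sum (map h (G b) ++ map h (concatMap G bs))
    ≡⟨ sum-++ (map h (G b)) _ ⟩
  sum (map h (G b)) ℕ.+ sum (map h (concatMap G bs))
    ≡⟨ cong (sum (map h (G b)) ℕ.+_) (sum-map-concatMap h G bs) ⟩
  sum (map (λ b → sum (map h (G b))) (b ∷ bs)) ∎

sum-map-∷ʳ : ∀ (g : ℕ → ℕ) xs x → sum (map g (xs ∷ʳ x)) ≡ sum (map g xs) ℕ.+ g x
sum-map-∷ʳ g xs x = begin
  sum (map g (xs ∷ʳ x))
    ≡⟨ cong sum (map-++ g xs (x ∷ [])) ⟩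
  sum (map g xs ++ g x ∷ [])
    ≡⟨ sum-++ (map g xs) (g x ∷ []) ⟩
  sum (map g xs) ℕ.+ (g x ℕ.+ 0)
    ≡⟨ cong (sum (map g xs) ℕ.+_) (ℕ.+-identityʳ (g x)) ⟩
  sum (map g xs) ℕ.+ g x ∎

sumℤ-upTo : ∀ n (g : ℕ → ℕ) → sumℤ n (λ j → + g j) ≡ + sum (map g (upTo (suc n)))
sumℤ-upTo zero    g = cong +_ (sym (ℕ.+-identityʳ (g 0)))
sumℤ-upTo (suc n) g = begin
  sumℤ n (λ j → + g j) + + g (suc n)
    ≡⟨ cong (_+ + g (suc n)) (sumℤ-upTo n g) ⟩
  + sum (map g (upTo (suc n))) + + g (suc n)
    ≡⟨ sym (ℤ.pos-+ (sum (map g (upTo (suc n)))) (g (suc n))) ⟩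
  + (sum (map g (upTo (suc n))) ℕ.+ g (suc n))
    ≡⟨ cong +_ (sym (sum-map-∷ʳ g (upTo (suc n)) (suc n))) ⟩
  + sum (map g (upTo (suc n) ∷ʳ suc n))
    ≡⟨ cong (λ xs → + sum (map g xs)) (upTo-∷ʳ (suc n)) ⟩
  + sum (map g (upTo (suc (suc n)))) ∎

sum-prodF₀-cons : ∀ {k} i (vs : List (Vec ℕ k)) →
  sum (map prodF₀ (map (i ∷_) vs)) ≡ f₀ i ℕ.* sum (map prodF₀ vs)
sum-prodF₀-cons i []       = sym (ℕ.*-zeroʳ (f₀ i))
sum-prodF₀-cons i (v ∷ vs) =
  trans (cong (f₀ i ℕ.* prodF₀ v ℕ.+_) (sum-prodF₀-cons i vs)) (sym (ℕ.*-distribˡ-+ (f₀ i) (prodF₀ v) _))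

-- f₀ itself is 1 at 0 (as 0 C 0 = 1); the composition recursion needs the value 0 there.
f₀′ : ℕ → ℕ
f₀′ zero    = 0
f₀′ (suc j) = f₀ (suc j)

c₁-suc : ∀ n k → + c₁ n (suc k) ≡ sumℤ n (λ j → + (f₀′ j ℕ.* c₁ (n ∸ j) k))
c₁-suc zero    k = refl
c₁-suc (suc n) k = begin
  + c₁ (suc n) (suc k)
    ≡⟨ cong +_ (sum-map-concatMap prodF₀ (λ j → map (suc j ∷_) (compositions (n ∸ j) k)) (upTo (suc n))) ⟩
  + sum (map (λ j → sum (map prodF₀ (map (suc j ∷_) (compositions (n ∸ j) k)))) (upTo (suc n)))
    ≡⟨ cong (λ xs → + sum xs)
            (map-cong (λ j → sum-prodF₀-cons (suc j) (compositions (n ∸ j) k)) (upTo (suc n))) ⟩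
  + sum (map (λ j → f₀ (suc j) ℕ.* c₁ (n ∸ j) k) (upTo (suc n)))
    ≡⟨ sym (sumℤ-upTo n _) ⟩
  sumℤ n (λ j → + (f₀ (suc j) ℕ.* c₁ (n ∸ j) k))
    ≡⟨ sym (ℤ.+-identityˡ _) ⟩
  + 0 + sumℤ n (λ j → + (f₀ (suc j) ℕ.* c₁ (n ∸ j) k))
    ≡⟨ sym (sumℤ-suc n _) ⟩
  sumℤ (suc n) (λ j → + (f₀′ j ℕ.* c₁ (suc n ∸ j) k)) ∎

n!≡nCk*[k!*[n∸k]!] : ∀ {n k} → k ≤ n → n ! ≡ (n C k) ℕ.* (k ! ℕ.* (n ∸ k) !)
n!≡nCk*[k!*[n∸k]!] {n} {k} k≤n =
  trans (sym (m/n*n≡m {{k ℕ.!* (n ∸ k) !≢0}} (k![n∸k]!∣n! k≤n)))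
        (cong (ℕ._* (k ! ℕ.* (n ∸ k) !)) (sym (nCk≡n!/k![n-k]! k≤n)))

2^n*∏[1+2t]*n!≡[2n]! : ∀ n → 2 ^ n ℕ.* prodℕ n (λ t → 1 ℕ.+ 2 ℕ.* t) ℕ.* n ! ≡ (2 ℕ.* n) !
2^n*∏[1+2t]*n!≡[2n]! zero    = refl
2^n*∏[1+2t]*n!≡[2n]! (suc n) = begin
  2 ^ suc n ℕ.* prodℕ (suc n) (λ t → 1 ℕ.+ 2 ℕ.* t) ℕ.* suc n !
    ≡⟨ regroup (2 ^ n) (prodℕ n (λ t → 1 ℕ.+ 2 ℕ.* t)) (n !) n ⟩
  (2 ℕ.+ 2 ℕ.* n) ℕ.* ((1 ℕ.+ 2 ℕ.* n) ℕ.* (2 ^ n ℕ.* prodℕ n (λ t → 1 ℕ.+ 2 ℕ.* t) ℕ.* n !))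
    ≡⟨ cong (λ m → (2 ℕ.+ 2 ℕ.* n) ℕ.* ((1 ℕ.+ 2 ℕ.* n) ℕ.* m)) (2^n*∏[1+2t]*n!≡[2n]! n) ⟩
  (2 ℕ.+ 2 ℕ.* n) !
    ≡⟨ cong _! (sym (ℕ.*-suc 2 n)) ⟩
  (2 ℕ.* suc n) ! ∎
  where
  regroup : ∀ q p f n → 2 ℕ.* q ℕ.* (p ℕ.* (1 ℕ.+ 2 ℕ.* n)) ℕ.* ((1 ℕ.+ n) ℕ.* f)
                        ≡ (2 ℕ.+ 2 ℕ.* n) ℕ.* ((1 ℕ.+ 2 ℕ.* n) ℕ.* (q ℕ.* p ℕ.* f))
  regroup = ℕ-Ring.solve-∀

2*n!*f₀n*n!≡[2n]! : ∀ n .{{_ : ℕ.NonZero n}} → 2 ℕ.* (n ! ℕ.* f₀ n) ℕ.* n ! ≡ (2 ℕ.* n) !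
2*n!*f₀n*n!≡[2n]! (suc n) = begin
  2 ℕ.* (suc n ! ℕ.* f₀ (suc n)) ℕ.* suc n !
    ≡⟨ cong (λ m → 2 ℕ.* (suc n ! ℕ.* ((m ∸ 1) C suc n)) ℕ.* suc n !) (ℕ.*-suc 2 n) ⟩
  2 ℕ.* (suc n ! ℕ.* (N C suc n)) ℕ.* suc n !
    ≡⟨ regroup (N C suc n) (n !) n ⟩
  (2 ℕ.+ 2 ℕ.* n) ℕ.* ((N C suc n) ℕ.* (suc n ! ℕ.* n !))
    ≡⟨ cong (λ m → (2 ℕ.+ 2 ℕ.* n) ℕ.* ((N C suc n) ℕ.* (suc n ! ℕ.* m !))) (sym N∸[1+n]≡n) ⟩
  (2 ℕ.+ 2 ℕ.* n) ℕ.* ((N C suc n) ℕ.* (suc n ! ℕ.* (N ∸ suc n) !))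
    ≡⟨ cong ((2 ℕ.+ 2 ℕ.* n) ℕ.*_) (sym (n!≡nCk*[k!*[n∸k]!] (ℕ.s≤s (ℕ.m≤m+n n (n ℕ.+ 0))))) ⟩
  (2 ℕ.+ 2 ℕ.* n) ℕ.* N !
    ≡⟨ cong _! (sym (ℕ.*-suc 2 n)) ⟩
  (2 ℕ.* suc n) ! ∎
  where
  N = suc (2 ℕ.* n)
  N∸[1+n]≡n : N ∸ suc n ≡ n
  N∸[1+n]≡n = trans (ℕ.m+n∸m≡n n (n ℕ.+ 0)) (ℕ.+-identityʳ n)
  regroup : ∀ c f n → 2 ℕ.* ((1 ℕ.+ n) ℕ.* f ℕ.* c) ℕ.* ((1 ℕ.+ n) ℕ.* f)
                      ≡ (2 ℕ.+ 2 ℕ.* n) ℕ.* (c ℕ.* ((1 ℕ.+ n) ℕ.* f ℕ.* f))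
  regroup = ℕ-Ring.solve-∀

scaledRising : ℕ → ℕ → ℤ
scaledRising i = rising (+ 4) (+ (2 ℕ.* i))

scaledRising≡2^n*∏ : ∀ i n → scaledRising i n ≡ + (2 ^ n ℕ.* prodℕ n (λ t → i ℕ.+ 2 ℕ.* t))
scaledRising≡2^n*∏ i zero    = refl
scaledRising≡2^n*∏ i (suc n) = begin
  scaledRising i n * (+ (2 ℕ.* i) + + 4 * + n)
    ≡⟨ cong₂ _*_ (scaledRising≡2^n*∏ i n) (cong (λ z → + (2 ℕ.* i) + z) (sym (ℤ.pos-* 4 n))) ⟩
  + (2 ^ n ℕ.* p) * (+ (2 ℕ.* i) + + (4 ℕ.* n))
    ≡⟨ cong (+ (2 ^ n ℕ.* p) *_) (sym (ℤ.pos-+ (2 ℕ.* i) (4 ℕ.* n))) ⟩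
  + (2 ^ n ℕ.* p) * + (2 ℕ.* i ℕ.+ 4 ℕ.* n)
    ≡⟨ sym (ℤ.pos-* (2 ^ n ℕ.* p) _) ⟩
  + (2 ^ n ℕ.* p ℕ.* (2 ℕ.* i ℕ.+ 4 ℕ.* n))
    ≡⟨ cong +_ (regroup (2 ^ n) p i n) ⟩
  + (2 ^ suc n ℕ.* prodℕ (suc n) (λ t → i ℕ.+ 2 ℕ.* t)) ∎
  where
  p = prodℕ n (λ t → i ℕ.+ 2 ℕ.* t)
  regroup : ∀ q p i n → q ℕ.* p ℕ.* (2 ℕ.* i ℕ.+ 4 ℕ.* n) ≡ 2 ℕ.* q ℕ.* (p ℕ.* (i ℕ.+ 2 ℕ.* n))
  regroup = ℕ-Ring.solve-∀

scaledRising-suc : ∀ i → scaledRising (suc i) ≗ scaledRising 1 ⋆ scaledRising i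
scaledRising-suc i n = begin
  rising (+ 4) (+ (2 ℕ.* suc i)) n
    ≡⟨ cong (λ x → rising (+ 4) x n) 2[1+i]≡2+2i ⟩
  rising (+ 4) (+ 2 + + (2 ℕ.* i)) n
    ≡⟨ rising-+ (+ 4) (+ 2) (+ (2 ℕ.* i)) n ⟩
  (scaledRising 1 ⋆ scaledRising i) n ∎
  where
  2[1+i]≡2+2i : + (2 ℕ.* suc i) ≡ + 2 + + (2 ℕ.* i)
  2[1+i]≡2+2i = trans (cong +_ (ℕ.*-suc 2 i)) (ℤ.pos-+ 2 (2 ℕ.* i))

scaledF₀ : ℕ → ℤ
scaledF₀ j = + (2 ℕ.* (j ! ℕ.* f₀′ j))

scaledF₀≡scaledRising-δ : ∀ j → scaledF₀ j ≡ scaledRising 1 j - δ j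
scaledF₀≡scaledRising-δ zero    = refl
scaledF₀≡scaledRising-δ (suc j) = begin
  + (2 ℕ.* (suc j ! ℕ.* f₀ (suc j)))
    ≡⟨ cong +_ cancel-[1+j]! ⟩
  + (2 ^ suc j ℕ.* prodℕ (suc j) (λ t → 1 ℕ.+ 2 ℕ.* t))
    ≡⟨ sym (scaledRising≡2^n*∏ 1 (suc j)) ⟩
  scaledRising 1 (suc j)
    ≡⟨ sym (ℤ.+-identityʳ _) ⟩
  scaledRising 1 (suc j) - + 0 ∎
  where
  cancel-[1+j]! : 2 ℕ.* (suc j ! ℕ.* f₀ (suc j)) ≡ 2 ^ suc j ℕ.* prodℕ (suc j) (λ t → 1 ℕ.+ 2 ℕ.* t)
  cancel-[1+j]! = ℕ.*-cancelʳ-≡ _ _ (suc j !) {{suc j ℕ.!≢0}}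
    (trans (2*n!*f₀n*n!≡[2n]! (suc j)) (sym (2^n*∏[1+2t]*n!≡[2n]! (suc j))))

scaledC₁ : ℕ → ℕ → ℤ
scaledC₁ k n = + (n ! ℕ.* c₁ n k ℕ.* 2 ^ k)

scaledC₁-zero : scaledC₁ 0 ≗ δ
scaledC₁-zero zero    = refl
scaledC₁-zero (suc n) = cong (λ m → + (m ℕ.* 1)) (ℕ.*-zeroʳ (suc n !))

pos-*-* : ∀ a b c → + (a ℕ.* b ℕ.* c) ≡ + a * + b * + c
pos-*-* a b c = trans (ℤ.pos-* (a ℕ.* b) c) (cong (_* + c) (ℤ.pos-* a b))

scaledC₁-suc : ∀ k → scaledC₁ (suc k) ≗ scaledF₀ ⋆ scaledC₁ k
scaledC₁-suc k n = begin
  + (n ! ℕ.* c₁ n (suc k) ℕ.* 2 ^ suc k)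
    ≡⟨ trans (cong +_ (x*y*z≡x*z*y (n !) (c₁ n (suc k)) (2 ^ suc k))) (ℤ.pos-* (n ! ℕ.* 2 ^ suc k) _) ⟩
  + (n ! ℕ.* 2 ^ suc k) * + c₁ n (suc k)
    ≡⟨ cong (+ (n ! ℕ.* 2 ^ suc k) *_) (c₁-suc n k) ⟩
  + (n ! ℕ.* 2 ^ suc k) * sumℤ n (λ j → + (f₀′ j ℕ.* c₁ (n ∸ j) k))
    ≡⟨ *-sumℤ n (+ (n ! ℕ.* 2 ^ suc k)) (λ j → + (f₀′ j ℕ.* c₁ (n ∸ j) k)) ⟩
  sumℤ n (λ j → + (n ! ℕ.* 2 ^ suc k) * + (f₀′ j ℕ.* c₁ (n ∸ j) k))
    ≡⟨ sumℤ-cong n term ⟩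
  (scaledF₀ ⋆ scaledC₁ k) n ∎
  where
  x*y*z≡x*z*y : ∀ x y z → x ℕ.* y ℕ.* z ≡ x ℕ.* z ℕ.* y
  x*y*z≡x*z*y = ℕ-Ring.solve-∀

  regroup : ∀ c a b f m p → c ℕ.* (a ℕ.* b) ℕ.* (2 ℕ.* p) ℕ.* (f ℕ.* m)
                            ≡ c ℕ.* (2 ℕ.* (a ℕ.* f)) ℕ.* (b ℕ.* m ℕ.* p)
  regroup = ℕ-Ring.solve-∀

  term : ∀ j → j ≤ n → + (n ! ℕ.* 2 ^ suc k) * + (f₀′ j ℕ.* c₁ (n ∸ j) k)
                       ≡ + (n C j) * scaledF₀ j * scaledC₁ k (n ∸ j)
  term j j≤n = begin
    + (n ! ℕ.* 2 ^ suc k) * + (f₀′ j ℕ.* c₁ (n ∸ j) k)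
      ≡⟨ sym (ℤ.pos-* (n ! ℕ.* 2 ^ suc k) _) ⟩
    + (n ! ℕ.* 2 ^ suc k ℕ.* (f₀′ j ℕ.* c₁ (n ∸ j) k))
      ≡⟨ cong (λ m → + (m ℕ.* 2 ^ suc k ℕ.* (f₀′ j ℕ.* c₁ (n ∸ j) k))) (n!≡nCk*[k!*[n∸k]!] j≤n) ⟩
    + ((n C j) ℕ.* (j ! ℕ.* (n ∸ j) !) ℕ.* 2 ^ suc k ℕ.* (f₀′ j ℕ.* c₁ (n ∸ j) k))
      ≡⟨ cong +_ (regroup (n C j) (j !) ((n ∸ j) !) (f₀′ j) (c₁ (n ∸ j) k) (2 ^ k)) ⟩
    + ((n C j) ℕ.* (2 ℕ.* (j ! ℕ.* f₀′ j)) ℕ.* ((n ∸ j) ! ℕ.* c₁ (n ∸ j) k ℕ.* 2 ^ k))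
      ≡⟨ pos-*-* (n C j) _ _ ⟩
    + (n C j) * scaledF₀ j * scaledC₁ k (n ∸ j) ∎

scaledC₁≡Δ : ∀ k n → scaledC₁ k n ≡ Δ k (λ i → scaledRising i n)
scaledC₁≡Δ zero    n = trans (scaledC₁-zero n) (sym (trans (ℤ.*-identityˡ _) (rising-zero (+ 4) n)))
scaledC₁≡Δ (suc k) n = begin
  scaledC₁ (suc k) n
    ≡⟨ scaledC₁-suc k n ⟩
  (scaledF₀ ⋆ scaledC₁ k) n
    ≡⟨ ⋆-cong {B = scaledC₁ k} scaledF₀≡scaledRising-δ (λ _ → refl) n ⟩
  ((λ j → R 1 j - δ j) ⋆ scaledC₁ k) n
    ≡⟨ ⋆-subˡ (R 1) δ (scaledC₁ k) n ⟩
  (R 1 ⋆ scaledC₁ k) n - (δ ⋆ scaledC₁ k) n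
    ≡⟨ cong₂ _-_ (⋆-cong (λ _ → refl) (scaledC₁≡Δ k) n) (trans (δ-⋆ (scaledC₁ k) n) (scaledC₁≡Δ k n)) ⟩
  (R 1 ⋆ (λ m → Δ k (λ i → R i m))) n - Δ k (λ i → R i n)
    ≡⟨ cong (_- Δ k (λ i → R i n)) (⋆-linearʳ (R 1) (λ i → sign (k ∸ i) * + (k C i)) R k n) ⟩
  Δ k (λ i → (R 1 ⋆ R i) n) - Δ k (λ i → R i n)
    ≡⟨ cong (_- Δ k (λ i → R i n)) (Δ-cong k (λ i → sym (scaledRising-suc i n))) ⟩
  Δ k (λ i → R (suc i) n) - Δ k (λ i → R i n)
    ≡⟨ sym (Δ-suc k (λ i → R i n)) ⟩
  Δ (suc k) (λ i → R i n) ∎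
  where
  R = scaledRising

mainTheorem18 : (n k : ℕ) → 1 ≤ k → k ≤ n →
    + ((n !) ℕ.* c₁ n k)
      ≡ + (2 ^ (n ∸ k))
        * sumℤ k (λ i → sign (k ∸ i) * + (k C i) * + prodℕ n (λ t → i ℕ.+ 2 ℕ.* t))
mainTheorem18 n k _ k≤n = ℤ.*-cancelʳ-≡ _ _ (+ (2 ^ k)) {{ℕ.m^n≢0 2 k}} (begin
  + (n ! ℕ.* c₁ n k) * + (2 ^ k)
    ≡⟨ sym (ℤ.pos-* (n ! ℕ.* c₁ n k) (2 ^ k)) ⟩
  scaledC₁ k n
    ≡⟨ scaledC₁≡Δ k n ⟩
  Δ k (λ i → scaledRising i n)
    ≡⟨ Δ-cong k (λ i → trans (scaledRising≡2^n*∏ i n) (ℤ.pos-* (2 ^ n) _)) ⟩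
  Δ k (λ i → + (2 ^ n) * + prodℕ n (λ t → i ℕ.+ 2 ℕ.* t))
    ≡⟨ Δ-* k (+ (2 ^ n)) _ ⟩
  + (2 ^ n) * D
    ≡⟨ cong (λ m → + m * D) 2^n≡2^[n∸k]*2^k ⟩
  + (2 ^ (n ∸ k) ℕ.* 2 ^ k) * D
    ≡⟨ cong (_* D) (ℤ.pos-* (2 ^ (n ∸ k)) (2 ^ k)) ⟩
  + (2 ^ (n ∸ k)) * + (2 ^ k) * D
    ≡⟨ x*y*z≡x*z*y (+ (2 ^ (n ∸ k))) (+ (2 ^ k)) D ⟩
  + (2 ^ (n ∸ k)) * D * + (2 ^ k) ∎)
  where
  D = Δ k (λ i → + prodℕ n (λ t → i ℕ.+ 2 ℕ.* t))
  2^n≡2^[n∸k]*2^k : 2 ^ n ≡ 2 ^ (n ∸ k) ℕ.* 2 ^ k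
  2^n≡2^[n∸k]*2^k = trans (cong (2 ^_) (sym (ℕ.m∸n+n≡m k≤n))) (ℕ.^-distribˡ-+-* 2 (n ∸ k) k)
  x*y*z≡x*z*y : ∀ x y z → x * y * z ≡ x * z * y
  x*y*z≡x*z*y = solve-∀
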